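{- Let $J_3:\mathbb{N}\to\mathbb{N}$ be the Josephus function with reduction constant $3$, and let $\{n_e^{(i)}\}_{i\in\mathbb{N}}$ be the strictly increasing enumeration of all high extremal points of $J_3$ (so $n_e^{(1)}=1$). For each $i$ set $f_i:=n_e^{(i)}-J_3(n_e^{(i)})\in\{0,1\}$ and $r_i:=n_e^{(i)} \bmod 2$. Then: (i) if $f_i=1$ and $r_i=0$, then $n_e^{(i+1)}=\frac{3n_e^{(i)}+2}{2}$ and $f_{i+1}=0$; (ii) if $f_i=1$ and $r_i=1$, then $n_e^{(i+1)}=\frac{3n_e^{(i)}+1}{2}$ and $f_{i+1}=1$; (iii) if $f_i=0$ and $r_i=0$, then $n_e^{(i+1)}=\frac{3n_e^{(i)}}{2}$ and $f_{i+1}=1$; (iv) if $f_i=0$ and $r_i=1$, then $n_e^{(i+1)}=\frac{3n_e^{(i)}+1}{2}$ and $f_{i+1}=0$.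
   Context: The Josephus function $J_3$: for $n\in\mathbb{N}=\{1,2,\dots\}$, place $n$ people numbered $1,\dots,n$ clockwise in a circle; starting the count at person $1$ and proceeding clockwise, count people and eliminate every third person (the first eliminated is person $3$), the circle closing ranks after each elimination, until one person remains; $J_3(n)\in\{1,\dots,n\}$ is the original number of the survivor. Equivalently $J_3(1)=1$ and $J_3(n)=((J_3(n-1)+2)\bmod n)+1$ for $n\ge 2$. A positive integer $n$ is a high extremal point of $J_3$ if $J_3(n)\in\{n-1,n\}$; it is a fixed point if $J_3(n)=n$, and a pure high extremal point if $J_3(n)=n-1$. -}

module Defs where

open import Data.Nat using (ℕ; zero; suc; _+_; _*_; _∸_; _<_; _≤_)
open import Data.Nat.DivMod using (_%_)
open import Data.Sum using (_⊎_)
open import Data.Product using (_×_)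
open import Relation.Nullary using (¬_)
open import Relation.Binary.PropositionalEquality using (_≡_)

-- Josephus function with reduction constant 3:
-- J3 1 = 1, J3 n = ((J3 (n-1) + 2) mod n) + 1 for n ≥ 2.
-- J3 0 is a dummy value (0); ℕ in the paper starts at 1.
J3 : ℕ → ℕ
J3 zero = zero
J3 (suc zero) = 1
J3 (suc (suc n)) = ((J3 (suc n) + 2) % suc (suc n)) + 1

HighExtremal : ℕ → Set
HighExtremal n = 1 ≤ n × (J3 n ≡ n ∸ 1 ⊎ J3 n ≡ n)

fval : ℕ → ℕ
fval n = n ∸ J3 n

NextHighExtremal : ℕ → ℕ → Set
NextHighExtremal n m =
  HighExtremal m × n < m × (∀ k → n < k → k < m → ¬ HighExtremal k)

{-# OPTIONS --safe #-}
module Submission where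

-- Write the gap of m as m − J3 m.  While the gap is at least 2 the recursion
-- J3 (m+1) = ((J3 m + 2) mod (m+1)) + 1 does not wrap around, so J3 grows by 3
-- while m grows by 1 and the gap drops by exactly 2; the high extremal points are
-- the m with gap 0 or 1.  Right after a high extremal point n with f = n − J3 n
-- the recursion wraps around to J3 (n+1) = 2 − f, giving gap n − 1 + f = 2t + g
-- with g ≤ 1.  Hence the next high extremal point is n + 1 + t, and its f-value
-- is g; the four cases of the theorem are the four parities of n and f.

open import Defs
open import Data.Nat using (ℕ; zero; suc; _+_; _*_; _∸_; _<_; _≤_; s≤s; z≤n)
open import Data.Nat.DivMod using (_%_; _/_; m*n/n≡m; [m+n]%n≡m%n; n%n≡0; m<n⇒m%n≡m; m≡m%n+[m/n]*n)
open import Data.Nat.Properties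
open import Data.Nat.Tactic.RingSolver using (solve-∀)
open import Data.Product using (_×_; _,_; proj₁; proj₂; ∃-syntax)
open import Data.Sum using (inj₁; inj₂)
open import Data.Empty using (⊥-elim)
open import Relation.Nullary using (¬_)
open import Relation.Binary.PropositionalEquality

J3-step : ∀ {m} → J3 (suc m) + 2 ≤ suc m → J3 (suc (suc m)) ≡ J3 (suc m) + 3
J3-step {m} le = begin
  (J3 (suc m) + 2) % suc (suc m) + 1 ≡⟨ cong (_+ 1) (m<n⇒m%n≡m (s≤s le)) ⟩
  J3 (suc m) + 2 + 1                 ≡⟨ +-assoc (J3 (suc m)) 2 1 ⟩
  J3 (suc m) + 3                     ∎
  where open ≡-Reasoning

J3-after-fixed-point : ∀ {k} → J3 (suc k) ≡ suc k → J3 (suc (suc k)) ≡ 2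
J3-after-fixed-point {k} j rewrite j =
  cong (_+ 1) (trans (cong (_% suc (suc k)) (+-comm (suc k) 2)) ([m+n]%n≡m%n 1 (suc (suc k))))

J3-after-pure-point : ∀ {k} → J3 (suc k) ≡ k → J3 (suc (suc k)) ≡ 1
J3-after-pure-point {k} j rewrite j =
  cong (_+ 1) (trans (cong (_% suc (suc k)) (+-comm k 2)) (n%n≡0 (suc (suc k))))

HighExtremal⇒≤1+J3 : ∀ {x} → HighExtremal x → x ≤ suc (J3 x)
HighExtremal⇒≤1+J3 {x} (_ , inj₁ j) rewrite j = m≤n+m∸n x 1
HighExtremal⇒≤1+J3 {x} (_ , inj₂ j) rewrite j = n≤1+n x

gap≥2⇒¬HighExtremal : ∀ {x e} → J3 x + (2 + e) ≡ x → ¬ HighExtremal x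
gap≥2⇒¬HighExtremal {x} {e} gap hx = <-irrefl refl (begin-strict
  x               ≤⟨ HighExtremal⇒≤1+J3 hx ⟩
  suc (J3 x)      <⟨ ≤-reflexive (+-comm 2 (J3 x)) ⟩
  J3 x + 2        ≤⟨ +-monoʳ-≤ (J3 x) (m≤m+n 2 e) ⟩
  J3 x + (2 + e)  ≡⟨ gap ⟩
  x               ∎)
  where open ≤-Reasoning

gap≤1⇒HighExtremal : ∀ {m g} → g ≤ 1 → J3 (suc m) + g ≡ suc m → HighExtremal (suc m)
gap≤1⇒HighExtremal {g = zero} _ gap = s≤s z≤n , inj₂ (trans (sym (+-identityʳ _)) gap)
gap≤1⇒HighExtremal {g = suc zero} _ gap =
  s≤s z≤n , inj₁ (trans (sym (m+n∸n≡m _ 1)) (cong (_∸ 1) gap))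
gap≤1⇒HighExtremal {g = suc (suc _)} (s≤s ()) _

gap⇒fval : ∀ {m g} → J3 m + g ≡ m → fval m ≡ g
gap⇒fval {m} {g} gap = trans (cong (_∸ J3 m) (sym gap)) (m+n∸m≡n (J3 m) g)

J3-descent : ∀ t {m g} → J3 (suc m) + (2 * t + g) ≡ suc m →
  J3 (suc m + t) + g ≡ suc m + t × (∀ x → suc m ≤ x → x < suc m + t → ¬ HighExtremal x)
J3-descent zero {m} gap rewrite +-identityʳ m = gap , λ x m≤x x<m → ⊥-elim (<⇒≱ x<m m≤x)
J3-descent (suc t) {m} {g} gap rewrite +-suc m t = proj₁ rest , between
  where
    open ≡-Reasoning
    e : ℕ
    e = 2 * t + g

    gap₂ : J3 (suc m) + (2 + e) ≡ suc m
    gap₂ = begin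
      J3 (suc m) + (2 + e)         ≡⟨ cong (J3 (suc m) +_) (sym (+-assoc 2 (2 * t) g)) ⟩
      J3 (suc m) + (2 + 2 * t + g) ≡⟨ cong (λ u → J3 (suc m) + (u + g)) (sym (*-suc 2 t)) ⟩
      J3 (suc m) + (2 * suc t + g) ≡⟨ gap ⟩
      suc m                        ∎

    gap′ : J3 (suc (suc m)) + e ≡ suc (suc m)
    gap′ = begin
      J3 (suc (suc m)) + e       ≡⟨ cong (_+ e) (J3-step no-wrap) ⟩
      J3 (suc m) + 3 + e         ≡⟨ trans (+-assoc (J3 (suc m)) 3 e) (+-suc (J3 (suc m)) (2 + e)) ⟩
      suc (J3 (suc m) + (2 + e)) ≡⟨ cong suc gap₂ ⟩
      suc (suc m)                ∎
      where
        no-wrap : J3 (suc m) + 2 ≤ suc m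
        no-wrap = subst (J3 (suc m) + 2 ≤_) gap₂ (+-monoʳ-≤ (J3 (suc m)) (m≤m+n 2 e))

    rest : J3 (suc (suc m) + t) + g ≡ suc (suc m) + t
         × (∀ x → suc (suc m) ≤ x → x < suc (suc m) + t → ¬ HighExtremal x)
    rest = J3-descent t gap′

    between : ∀ x → suc m ≤ x → x < suc (suc m + t) → ¬ HighExtremal x
    between x m≤x x<m with m≤n⇒m<n∨m≡n m≤x
    ... | inj₁ m<x  = proj₂ rest x m<x x<m
    ... | inj₂ refl = gap≥2⇒¬HighExtremal gap₂

gap⇒NextHighExtremal : ∀ {k} t {g} → g ≤ 1 → J3 (suc k) + (2 * t + g) ≡ suc k →
  NextHighExtremal k (suc k + t) × fval (suc k + t) ≡ g
gap⇒NextHighExtremal {k} t {g} g≤1 gap =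
  (gap≤1⇒HighExtremal g≤1 reached , s≤s (m≤m+n k t) , skipped) , gap⇒fval reached
  where
    reached : J3 (suc k + t) + g ≡ suc k + t
    reached = proj₁ (J3-descent t gap)
    skipped : ∀ x → suc k ≤ x → x < suc k + t → ¬ HighExtremal x
    skipped = proj₂ (J3-descent t gap)

HighExtremal⇒gap-after : ∀ {k} → HighExtremal (suc k) →
  J3 (suc (suc k)) + (k + fval (suc k)) ≡ suc (suc k)
HighExtremal⇒gap-after {k} (_ , inj₁ j)
  rewrite J3-after-pure-point j | j | m+n∸n≡m 1 k | +-comm k 1 = refl
HighExtremal⇒gap-after {k} (_ , inj₂ j)
  rewrite J3-after-fixed-point j | j | n∸n≡0 k | +-identityʳ k = refl

NextHighExtremal-after : ∀ {n} t {g} → HighExtremal n → n ∸ 1 + fval n ≡ 2 * t + g → g ≤ 1 →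
  NextHighExtremal n (suc n + t) × fval (suc n + t) ≡ g
NextHighExtremal-after {zero} t (() , _) split g≤1
NextHighExtremal-after {suc k} t he split g≤1 =
  gap⇒NextHighExtremal t g≤1
    (subst (λ e → J3 (suc (suc k)) + e ≡ suc (suc k)) split (HighExtremal⇒gap-after he))

NextHighExtremal-at-half : ∀ {n} t {g a} → HighExtremal n → n ∸ 1 + fval n ≡ 2 * t + g → g ≤ 1 →
  a ≡ (suc n + t) * 2 → NextHighExtremal n (a / 2) × fval (a / 2) ≡ g
NextHighExtremal-at-half {n} t {g} he split g≤1 refl =
  subst (λ m → NextHighExtremal n m × fval m ≡ g) (sym (m*n/n≡m (suc n + t) 2))
        (NextHighExtremal-after t he split g≤1)

even⇒≡2+2* : ∀ {n} → 1 ≤ n → n % 2 ≡ 0 → ∃[ p ] n ≡ 2 + 2 * p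
even⇒≡2+2* {n} 1≤n r with n / 2 | m≡m%n+[m/n]*n n 2
... | zero  | d rewrite r = ⊥-elim (<⇒≢ 1≤n (sym d))
... | suc p | d rewrite r = p , trans d (cong (2 +_) (*-comm p 2))

odd⇒≡1+2* : ∀ {n} → n % 2 ≡ 1 → ∃[ p ] n ≡ 1 + 2 * p
odd⇒≡1+2* {n} r with n / 2 | m≡m%n+[m/n]*n n 2
... | p | d rewrite r = p , trans d (cong suc (*-comm p 2))

pure-even : ∀ {n} → HighExtremal n → fval n ≡ 1 → n % 2 ≡ 0 →
  NextHighExtremal n ((3 * n + 2) / 2) × fval ((3 * n + 2) / 2) ≡ 0
pure-even he f r with even⇒≡2+2* (proj₁ he) r
... | p , refl =
  NextHighExtremal-at-half (suc p) he (trans (cong (1 + 2 * p +_) f) (split p)) z≤n (doubled p)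
  where
    split : ∀ p → 1 + 2 * p + 1 ≡ 2 * suc p + 0
    split = solve-∀
    doubled : ∀ p → 3 * (2 + 2 * p) + 2 ≡ (3 + 2 * p + suc p) * 2
    doubled = solve-∀

3*[1+2*p]+1≡[2+2*p+p]*2 : ∀ p → 3 * (1 + 2 * p) + 1 ≡ (2 + 2 * p + p) * 2
3*[1+2*p]+1≡[2+2*p+p]*2 = solve-∀

pure-odd : ∀ {n} → HighExtremal n → fval n ≡ 1 → n % 2 ≡ 1 →
  NextHighExtremal n ((3 * n + 1) / 2) × fval ((3 * n + 1) / 2) ≡ 1
pure-odd {n} he f r with odd⇒≡1+2* {n} r
... | p , refl =
  NextHighExtremal-at-half p he (cong (2 * p +_) f) ≤-refl (3*[1+2*p]+1≡[2+2*p+p]*2 p)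

fixed-even : ∀ {n} → HighExtremal n → fval n ≡ 0 → n % 2 ≡ 0 →
  NextHighExtremal n ((3 * n) / 2) × fval ((3 * n) / 2) ≡ 1
fixed-even he f r with even⇒≡2+2* (proj₁ he) r
... | p , refl =
  NextHighExtremal-at-half p he (trans (cong (1 + 2 * p +_) f) (split p)) ≤-refl (doubled p)
  where
    split : ∀ p → 1 + 2 * p + 0 ≡ 2 * p + 1
    split = solve-∀
    doubled : ∀ p → 3 * (2 + 2 * p) ≡ (3 + 2 * p + p) * 2
    doubled = solve-∀

fixed-odd : ∀ {n} → HighExtremal n → fval n ≡ 0 → n % 2 ≡ 1 →
  NextHighExtremal n ((3 * n + 1) / 2) × fval ((3 * n + 1) / 2) ≡ 0
fixed-odd {n} he f r with odd⇒≡1+2* {n} r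
... | p , refl =
  NextHighExtremal-at-half p he (cong (2 * p +_) f) z≤n (3*[1+2*p]+1≡[2+2*p+p]*2 p)

theorem1 : ∀ (n : ℕ) → HighExtremal n →
    ((fval n ≡ 1 → n % 2 ≡ 0 →
        NextHighExtremal n ((3 * n + 2) / 2) × fval ((3 * n + 2) / 2) ≡ 0)
    × (fval n ≡ 1 → n % 2 ≡ 1 →
        NextHighExtremal n ((3 * n + 1) / 2) × fval ((3 * n + 1) / 2) ≡ 1)
    × (fval n ≡ 0 → n % 2 ≡ 0 →
        NextHighExtremal n ((3 * n) / 2) × fval ((3 * n) / 2) ≡ 1)
    × (fval n ≡ 0 → n % 2 ≡ 1 →
        NextHighExtremal n ((3 * n + 1) / 2) × fval ((3 * n + 1) / 2) ≡ 0))
theorem1 n he = pure-even he , pure-odd he , fixed-even he , fixed-odd he
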